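{- Let $\sigma$ and $\tau$ be classical patterns. Then $\sigma$ and $\tau$ are shape-Wilf-equivalent if and only if they are filling-shape-Wilf-equivalent.
   Context: A classical pattern is a permutation $\sigma\in S_k$. A Young board $\lambda=(\lambda_1,\dots,\lambda_n)$ with $\lambda_1\ge\dots\ge\lambda_n>0$ is the cell set $\{(i,j):1\le i\le n,\ 1\le j\le \lambda_i\}$, with width $n$ and height $\lambda_1$. A filling of $\lambda$ is a $0/1$ assignment to the cells with at most one $1$ per row and per column. It is encoded by the word $\pi_1\cdots\pi_n$ with $\pi_c=r$ if cell $(c,r)$ holds a $1$ and $\pi_c=\square$ if column $c$ is empty. It is standard if each row and column contains exactly one $1$. A filling $\pi$ contains $\sigma\in S_k$ if there are $i_1<\dots<i_k$ such that all of the following hold: - the $\pi_{i_j}$ are numbers; - $\pi_{i_1}\cdots\pi_{i_k}$ is order-isomorphic to $\sigma$; - the cell $(i_k,\max_j \pi_{i_j})$ lies in $\lambda$. Otherwise $\pi$ avoids $\sigma$. $\sigma,\tau$ are shape-Wilf-equivalent if, for every Young board $\lambda$, the numbers of standard fillings of $\lambda$ avoiding $\sigma$ and avoiding $\tau$ are equal. They are filling-shape-Wilf-equivalent if, for every Young board $\lambda$ and all $C\subseteq[\text{width}]$, $R\subseteq[\text{height}]$, the number of fillings of $\lambda$ with empty columns exactly $C$ and empty rows exactly $R$ that avoid $\sigma$ equals the corresponding number for $\tau$. -}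

module Defs where

open import Data.Nat as ℕ using (ℕ; zero; suc; _<_; _≤_)
open import Data.Fin as Fin using (Fin; fromℕ)
open import Data.Fin.Permutation using (Permutation′; _⟨$⟩ʳ_)
open import Data.Fin.Subset using (Subset; _∈_)
open import Data.Vec using (Vec; lookup; head)
open import Data.Maybe using (Maybe; just; nothing)
open import Data.List using (List; length)
open import Data.List.Membership.Propositional renaming (_∈_ to _∈ₗ_)
open import Data.List.Relation.Unary.Unique.Propositional using (Unique)
open import Data.Product using (Σ; ∃; ∃-syntax; _×_; _,_)
open import Function.Bundles using (_⇔_)
open import Relation.Binary.PropositionalEquality using (_≡_)
open import Relation.Nullary using (¬_)

-- Conventions: columns are indexed by Fin (suc n) (0-based, column c+1 of
-- the paper is index c); rows are 0-based as well: a filled cell in row r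
-- (0-based) of column c lies in the board iff r < λ_c.

IsYoung : ∀ {n} → Vec ℕ (suc n) → Set
IsYoung {n} λs =
  (∀ (i : Fin (suc n)) → 0 < lookup λs i) ×
  (∀ (i j : Fin (suc n)) → i Fin.≤ j → lookup λs j ≤ lookup λs i)

height : ∀ {n} → Vec ℕ (suc n) → ℕ
height = head

-- A word π_1⋯π_{n+1}; nothing = □ (empty column), just r = 1 in row r.
Word : ℕ → Set
Word n = Vec (Maybe ℕ) (suc n)

-- A filling of λ: every 1 lies in the board, at most one 1 per row
-- (at most one per column is automatic from the word encoding).
IsFilling : ∀ {n} → Vec ℕ (suc n) → Word n → Set
IsFilling {n} λs π =
  (∀ (c : Fin (suc n)) (r : ℕ) → lookup π c ≡ just r → r < lookup λs c) ×
  (∀ (c c′ : Fin (suc n)) (r : ℕ) → lookup π c ≡ just r → lookup π c′ ≡ just r → c ≡ c′)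

IsStandard : ∀ {n} → Vec ℕ (suc n) → Word n → Set
IsStandard {n} λs π =
  IsFilling λs π ×
  (∀ (c : Fin (suc n)) → ∃[ r ] lookup π c ≡ just r) ×
  (∀ (r : ℕ) → r < height λs → ∃[ c ] lookup π c ≡ just r)

EmptyColumnsExactly : ∀ {n} → Word n → Subset (suc n) → Set
EmptyColumnsExactly {n} π C = ∀ (c : Fin (suc n)) → (c ∈ C ⇔ lookup π c ≡ nothing)

EmptyRowsExactly : ∀ {n} (λs : Vec ℕ (suc n)) → Word n → Subset (height λs) → Set
EmptyRowsExactly {n} λs π R =
  ∀ (r : Fin (height λs)) → (r ∈ R ⇔ (¬ (∃[ c ] lookup π c ≡ just (Fin.toℕ r))))

-- Containment of a classical pattern σ ∈ S_{k+1} in a filling π of λ: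
-- indices ι(0) < … < ι(k) of nonempty columns with values v, the word v
-- order-isomorphic to σ, and the cell (ι(k), max v) inside λ
-- (i.e. every v j < λ_{ι(k)}, which is equivalent to max v < λ_{ι(k)}).
Contains : ∀ {k n} → Permutation′ (suc k) → Vec ℕ (suc n) → Word n → Set
Contains {k} {n} σ λs π =
  Σ (Fin (suc k) → Fin (suc n)) λ ι →
  Σ (Fin (suc k) → ℕ) λ v →
    (∀ (a b : Fin (suc k)) → a Fin.< b → ι a Fin.< ι b) ×
    (∀ (j : Fin (suc k)) → lookup π (ι j) ≡ just (v j)) ×
    (∀ (a b : Fin (suc k)) → (v a < v b ⇔ (σ ⟨$⟩ʳ a) Fin.< (σ ⟨$⟩ʳ b))) ×
    (∀ (j : Fin (suc k)) → v j < lookup λs (ι (fromℕ k)))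

Avoids : ∀ {k n} → Permutation′ (suc k) → Vec ℕ (suc n) → Word n → Set
Avoids σ λs π = ¬ Contains σ λs π

HasSize : {A : Set} → (A → Set) → ℕ → Set
HasSize {A} P m =
  Σ (List A) λ L → Unique L × (∀ (x : A) → (x ∈ₗ L ⇔ P x)) × length L ≡ m

SameSize : {A : Set} → (A → Set) → (A → Set) → Set
SameSize P Q = ∀ (m : ℕ) → (HasSize P m ⇔ HasSize Q m)

ShapeWilfEquivalent : ∀ {k l} → Permutation′ (suc k) → Permutation′ (suc l) → Set
ShapeWilfEquivalent σ τ =
  ∀ (n : ℕ) (λs : Vec ℕ (suc n)) → IsYoung λs →
    SameSize (λ (π : Word n) → IsStandard λs π × Avoids σ λs π)
             (λ (π : Word n) → IsStandard λs π × Avoids τ λs π)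

FillingShapeWilfEquivalent : ∀ {k l} → Permutation′ (suc k) → Permutation′ (suc l) → Set
FillingShapeWilfEquivalent σ τ =
  ∀ (n : ℕ) (λs : Vec ℕ (suc n)) → IsYoung λs →
  ∀ (C : Subset (suc n)) (R : Subset (height λs)) →
    SameSize (λ (π : Word n) → IsFilling λs π × EmptyColumnsExactly π C ×
                               EmptyRowsExactly λs π R × Avoids σ λs π)
             (λ (π : Word n) → IsFilling λs π × EmptyColumnsExactly π C ×
                               EmptyRowsExactly λs π R × Avoids τ λs π)

module Submission where

-- Relax the filling-shape-Wilf data: the empty columns are
-- given by a subset C and the empty rows by a marker E : ℕ → Bool on all
-- of ℕ which marks every row from some bound B on (rows above the board are
-- always empty).  Counts are compared through correspondences, i.e.
-- bijections between the elements satisfying two predicates.  Deleting a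
-- marked column (Vec.removeAt) or a marked row (relabelling the rows by the
-- gap-closing map punchOutℕ) is such a bijection between relaxed fillings,
-- and it preserves avoidance of every pattern.  After all marked columns
-- and all marked rows below the height are deleted, either the data
-- describes the standard fillings of a Young board, where shape-Wilf-
-- equivalence applies, or no filling exists at all.  This proves
-- "shape-Wilf ⇒ filling-shape-Wilf"; the converse is the case C = R = ∅.

open import Defs
open import Data.Nat using (ℕ; suc)
open import Data.Fin.Permutation using (Permutation′)
open import Function.Bundles using (_⇔_)

open import Data.Nat using (zero; pred; _<_; _≤_; z≤n; s≤s; s≤s⁻¹; _<?_; _≤?_)
import Data.Nat.Properties as ℕ
open import Data.Bool using (Bool; true; false)
import Data.Bool.Properties as Bool
open import Data.Fin as Fin using (Fin; punchIn; punchOut; fromℕ; fromℕ<; toℕ)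
open import Data.Fin.Properties
  using (any?; all?; toℕ<n; toℕ-fromℕ<; fromℕ<-toℕ; ≤∧≢⇒<; <⇒≢; punchIn-injective; punchIn-mono-≤;
         punchOut-injective; punchOut-mono-≤; punchOut-punchIn)
open import Data.Fin.Permutation using (_⟨$⟩ʳ_)
open import Data.Fin.Subset as Subset using (Subset; _∈_)
open import Data.Vec as Vec using (Vec; _∷_; lookup; removeAt; insertAt)
open import Data.Vec.Properties
  using (lookup-map; removeAt-punchOut; insertAt-lookup; removeAt-insertAt; insertAt-removeAt;
         tabulate∘lookup; tabulate-cong; lookup-replicate; []=⇒lookup; lookup⇒[]=)
open import Data.Maybe as Maybe using (Maybe; just; nothing)
import Data.Maybe.Properties as Maybe
open import Data.List as List using ([]; _∷_)
open import Data.List.Properties using (length-map)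
open import Data.List.Membership.Propositional using () renaming (_∈_ to _∈ₗ_)
open import Data.List.Membership.Propositional.Properties using (∈-map⁺; ∈-map⁻)
open import Data.List.Relation.Unary.All as All using (All; []; _∷_)
open import Data.List.Relation.Unary.All.Properties using () renaming (map⁺ to All-map⁺)
open import Data.List.Relation.Unary.Any using (here)
open import Data.List.Relation.Unary.Unique.Propositional using (Unique)
open import Data.List.Relation.Unary.AllPairs.Core using ([]; _∷_)
open import Data.Product using (∃-syntax; _×_; _,_; proj₁; proj₂)
open import Data.Product.Function.NonDependent.Propositional using (_×-⇔_)
open import Data.Empty using (⊥-elim)
open import Function using (_∘_)
open import Function.Bundles using (mk⇔; Equivalence)
import Function.Properties.Equivalence as ⇔
open import Function.Related.TypeIsomorphisms using (¬-cong-⇔)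
open import Relation.Binary.Definitions using (tri<; tri≈; tri>)
open import Relation.Binary.PropositionalEquality using (_≡_; _≢_; refl; sym; trans; cong; subst; subst₂)
open import Relation.Nullary using (¬_; Dec; yes; no)
open import Relation.Nullary.Decidable using (_×-dec_; _→-dec_)

open Equivalence using (to; from)

⇔-onRight : {I : Set} {A B B′ : I → Set} → (∀ i → B i ⇔ B′ i) →
            (∀ i → A i ⇔ B i) ⇔ (∀ i → A i ⇔ B′ i)
⇔-onRight e = mk⇔ (λ f i → ⇔.trans (f i) (e i)) (λ f i → ⇔.trans (f i) (⇔.sym (e i)))

record Correspondence {A B : Set} (P : A → Set) (Q : B → Set) : Set where
  field
    forward          : A → B
    backward         : B → A
    forward-sound    : ∀ x → P x → Q (forward x)
    backward-sound   : ∀ y → Q y → P (backward y)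
    backward-forward : ∀ x → P x → backward (forward x) ≡ x
    forward-backward : ∀ y → Q y → forward (backward y) ≡ y

  forward-injective : ∀ {x y} → P x → P y → forward x ≡ forward y → x ≡ y
  forward-injective {x} {y} px py eq =
    trans (sym (backward-forward x px)) (trans (cong backward eq) (backward-forward y py))

inverse : {A B : Set} {P : A → Set} {Q : B → Set} → Correspondence P Q → Correspondence Q P
inverse φ = record
  { forward = backward ; backward = forward
  ; forward-sound = backward-sound ; backward-sound = forward-sound
  ; backward-forward = forward-backward ; forward-backward = backward-forward }
  where open Correspondence φ

pointwise : {A : Set} {P Q : A → Set} → (∀ x → P x ⇔ Q x) → Correspondence P Q
pointwise e = record
  { forward = λ x → x ; backward = λ y → y
  ; forward-sound = λ x → to (e x) ; backward-sound = λ y → from (e y)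
  ; backward-forward = λ _ _ → refl ; forward-backward = λ _ _ → refl }

hasSize-transport : {A B : Set} {P : A → Set} {Q : B → Set} {m : ℕ} →
                    Correspondence P Q → HasSize P m → HasSize Q m
hasSize-transport {P = P} {Q} φ (L , unique , members , len) =
  List.map forward L , map-unique satisfied unique , members′ , trans (length-map forward L) len
  where
  open Correspondence φ
  satisfied : All P L
  satisfied = All.tabulate (λ {x} x∈L → to (members x) x∈L)
  map-unique : ∀ {M} → All P M → Unique M → Unique (List.map forward M)
  map-unique [] [] = []
  map-unique (px ∷ pM) (x∉M ∷ uM) =
    All-map⁺ (All.zipWith (λ (x≢y , py) → x≢y ∘ forward-injective px py) (x∉M , pM)) ∷ map-unique pM uM
  members′ : ∀ y → (y ∈ₗ List.map forward L) ⇔ Q y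
  members′ y = mk⇔
    (λ y∈ → let (x , x∈L , y≡) = ∈-map⁻ forward y∈ in
            subst Q (sym y≡) (forward-sound x (to (members x) x∈L)))
    (λ qy → subst (_∈ₗ List.map forward L) (forward-backward y qy)
                  (∈-map⁺ forward (from (members (backward y)) (backward-sound y qy))))

sameSize-transport : {A B : Set} {P Q : A → Set} {P′ Q′ : B → Set} →
  Correspondence P P′ → Correspondence Q Q′ → SameSize P′ Q′ → SameSize P Q
sameSize-transport φ ψ same m =
  mk⇔ (hasSize-transport (inverse ψ) ∘ to (same m) ∘ hasSize-transport φ)
      (hasSize-transport (inverse φ) ∘ from (same m) ∘ hasSize-transport ψ)

sameSize-⇔ : {A : Set} {P Q : A → Set} → (∀ x → P x ⇔ Q x) → SameSize P Q
sameSize-⇔ e m = mk⇔ (hasSize-transport (pointwise e)) (hasSize-transport (inverse (pointwise e)))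

hasSize-empty : {A : Set} {P : A → Set} {m : ℕ} → (∀ x → ¬ P x) → HasSize P m ⇔ m ≡ 0
hasSize-empty {P = P} ¬P = mk⇔ size-zero (λ { refl → [] , [] , (λ x → mk⇔ (λ ()) (⊥-elim ∘ ¬P x)) , refl })
  where
  size-zero : ∀ {m} → HasSize P m → m ≡ 0
  size-zero ([] , _ , _ , len) = sym len
  size-zero (x ∷ _ , _ , members , _) = ⊥-elim (¬P x (to (members x) (here refl)))

sameSize-empty : {A : Set} {P Q : A → Set} → (∀ x → ¬ P x) → (∀ x → ¬ Q x) → SameSize P Q
sameSize-empty ¬P ¬Q m = ⇔.trans (hasSize-empty ¬P) (⇔.sym (hasSize-empty ¬Q))

RowEmpty : ∀ {n} → Word n → ℕ → Set
RowEmpty π r = ¬ (∃[ c ] lookup π c ≡ just r)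

EmptyColumns : ∀ {n} → Word n → Subset (suc n) → Set
EmptyColumns {n} π C = ∀ (c : Fin (suc n)) → (lookup C c ≡ true) ⇔ (lookup π c ≡ nothing)

EmptyRows : ∀ {n} → Word n → (ℕ → Bool) → Set
EmptyRows π E = ∀ r → (E r ≡ true) ⇔ RowEmpty π r

AvoidingFilling : ∀ {k n} → Permutation′ (suc k) → Vec ℕ (suc n) → Subset (suc n) → (ℕ → Bool) →
                  Word n → Set
AvoidingFilling ρ λs C E π = IsFilling λs π × EmptyColumns π C × EmptyRows π E × Avoids ρ λs π

-- The column heights are weakly decreasing (a Young board may have columns
-- of height 0 once rows are deleted).
Decreasing : ∀ {n} → Vec ℕ (suc n) → Set
Decreasing {n} λs = ∀ (i j : Fin (suc n)) → i Fin.≤ j → lookup λs j ≤ lookup λs i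

below-height : ∀ {n} (λs : Vec ℕ (suc n)) (π : Word n) → Decreasing λs → IsFilling λs π →
               ∀ c {v} → lookup π c ≡ just v → v < height λs
below-height (h ∷ hs) π decreasing (inside , _) c eq = ℕ.<-≤-trans (inside c _ eq) (decreasing Fin.zero c z≤n)

avoids-if-empty : ∀ {k n} (ρ : Permutation′ (suc k)) (λs : Vec ℕ (suc n)) (π : Word n) →
                  (∀ c → lookup π c ≡ nothing) → Avoids ρ λs π
avoids-if-empty ρ λs π empty (ι , v , _ , values , _) with trans (sym (values Fin.zero)) (empty (ι Fin.zero))
... | ()

lookup-removeAt : {A : Set} {m : ℕ} (xs : Vec A (suc m)) (c : Fin (suc m)) (i : Fin m) →
                  lookup (removeAt xs c) i ≡ lookup xs (punchIn c i)
lookup-removeAt xs c i =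
  trans (cong (lookup (removeAt xs c)) (sym (punchOut-punchIn c))) (removeAt-punchOut xs _)

punchIn-mono-< : ∀ {m} (c : Fin (suc m)) {a b : Fin m} → a Fin.< b → punchIn c a Fin.< punchIn c b
punchIn-mono-< c {a} {b} a<b =
  ≤∧≢⇒< (punchIn-mono-≤ c a b (ℕ.<⇒≤ a<b)) (<⇒≢ a<b ∘ punchIn-injective c a b)

punchOut-mono-< : ∀ {m} {c a b : Fin (suc m)} (c≢a : c ≢ a) (c≢b : c ≢ b) →
                  a Fin.< b → punchOut c≢a Fin.< punchOut c≢b
punchOut-mono-< c≢a c≢b a<b =
  ≤∧≢⇒< (punchOut-mono-≤ c≢a c≢b (ℕ.<⇒≤ a<b)) (<⇒≢ a<b ∘ punchOut-injective c≢a c≢b)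

module ColumnDeletion {m : ℕ} (λs : Vec ℕ (suc (suc m))) (c : Fin (suc (suc m)))
                      (π : Word (suc m)) (c-empty : lookup π c ≡ nothing) where

  λ′ : Vec ℕ (suc m)
  λ′ = removeAt λs c

  π′ : Word m
  π′ = removeAt π c

  filled≢c : ∀ {j r} → lookup π j ≡ just r → c ≢ j
  filled≢c eq refl with trans (sym eq) c-empty
  ... | ()

  shift : ∀ {j r} (eq : lookup π j ≡ just r) → lookup π′ (punchOut (filled≢c eq)) ≡ just r
  shift eq = trans (removeAt-punchOut π (filled≢c eq)) eq

  unshift : ∀ {i r} → lookup π′ i ≡ just r → lookup π (punchIn c i) ≡ just r
  unshift {i} eq = trans (sym (lookup-removeAt π c i)) eq

  filling-⇔ : IsFilling λs π ⇔ IsFilling λ′ π′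
  filling-⇔ = mk⇔ shrink grow
    where
    shrink : IsFilling λs π → IsFilling λ′ π′
    shrink (inside , rowUnique) =
      (λ i r eq → subst (r <_) (sym (lookup-removeAt λs c i)) (inside _ r (unshift eq))) ,
      (λ i i′ r eq eq′ → punchIn-injective c i i′ (rowUnique _ _ r (unshift eq) (unshift eq′)))
    grow : IsFilling λ′ π′ → IsFilling λs π
    grow (inside , rowUnique) =
      (λ j r eq → subst (r <_) (removeAt-punchOut λs (filled≢c eq)) (inside _ r (shift eq))) ,
      (λ j j′ r eq eq′ → punchOut-injective (filled≢c eq) (filled≢c eq′) (rowUnique _ _ r (shift eq) (shift eq′)))

  emptyColumns-⇔ : ∀ C → lookup C c ≡ true → EmptyColumns π C ⇔ EmptyColumns π′ (removeAt C c)
  emptyColumns-⇔ C c-marked = mk⇔ shrink grow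
    where
    Agree : Bool → Maybe ℕ → Set
    Agree x y = (x ≡ true) ⇔ (y ≡ nothing)
    shrink : EmptyColumns π C → EmptyColumns π′ (removeAt C c)
    shrink columns i =
      subst₂ Agree (sym (lookup-removeAt C c i)) (sym (lookup-removeAt π c i)) (columns (punchIn c i))
    grow : EmptyColumns π′ (removeAt C c) → EmptyColumns π C
    grow columns j with c Fin.≟ j
    ... | yes refl = mk⇔ (λ _ → c-empty) (λ _ → c-marked)
    ... | no c≢j = subst₂ Agree (removeAt-punchOut C c≢j) (removeAt-punchOut π c≢j) (columns (punchOut c≢j))

  emptyRows-⇔ : ∀ E → EmptyRows π E ⇔ EmptyRows π′ E
  emptyRows-⇔ E = ⇔-onRight (λ r → ¬-cong-⇔ (mk⇔ (λ (j , eq) → _ , shift eq) (λ (i , eq) → _ , unshift eq)))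

  contains-⇔ : ∀ {k} (ρ : Permutation′ (suc k)) → Contains ρ λs π ⇔ Contains ρ λ′ π′
  contains-⇔ {k} ρ = mk⇔ shrink grow
    where
    shrink : Contains ρ λs π → Contains ρ λ′ π′
    shrink (ι , v , increasing , values , order , inside) =
      (λ j → punchOut (filled≢c (values j))) , v ,
      (λ a b a<b → punchOut-mono-< (filled≢c (values a)) (filled≢c (values b)) (increasing a b a<b)) ,
      (λ j → shift (values j)) , order ,
      (λ j → subst (v j <_) (sym (removeAt-punchOut λs (filled≢c (values (fromℕ k))))) (inside j))
    grow : Contains ρ λ′ π′ → Contains ρ λs π
    grow (ι , v , increasing , values , order , inside) =
      (λ j → punchIn c (ι j)) , v , (λ a b a<b → punchIn-mono-< c (increasing a b a<b)) ,
      (λ j → unshift (values j)) , order ,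
      (λ j → subst (v j <_) (lookup-removeAt λs c (ι (fromℕ k))) (inside j))

  avoidingFilling-⇔ : ∀ {k} (ρ : Permutation′ (suc k)) C E → lookup C c ≡ true →
    AvoidingFilling ρ λs C E π ⇔ AvoidingFilling ρ λ′ (removeAt C c) E π′
  avoidingFilling-⇔ ρ C E c-marked =
    filling-⇔ ×-⇔ emptyColumns-⇔ C c-marked ×-⇔ emptyRows-⇔ E ×-⇔ ¬-cong-⇔ (contains-⇔ ρ)

deleteColumn : ∀ {k m} (ρ : Permutation′ (suc k)) (λs : Vec ℕ (suc (suc m))) C E c →
  lookup C c ≡ true →
  Correspondence (AvoidingFilling ρ λs C E) (AvoidingFilling ρ (removeAt λs c) (removeAt C c) E)
deleteColumn ρ λs C E c c-marked = record
  { forward = λ π → removeAt π c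
  ; backward = λ π′ → insertAt π′ c nothing
  ; forward-sound = λ π F → to (deletion π (empty π F)) F
  ; backward-sound = λ π′ F′ →
      from (deletion (insertAt π′ c nothing) (insertAt-lookup π′ c nothing))
           (subst (AvoidingFilling ρ (removeAt λs c) (removeAt C c) E) (sym (removeAt-insertAt π′ c nothing)) F′)
  ; backward-forward = λ π F →
      trans (cong (insertAt (removeAt π c) c) (sym (empty π F))) (insertAt-removeAt π c)
  ; forward-backward = λ π′ _ → removeAt-insertAt π′ c nothing
  }
  where
  empty : ∀ π → AvoidingFilling ρ λs C E π → lookup π c ≡ nothing
  empty π (_ , columns , _) = to (columns c) c-marked
  deletion : ∀ π → lookup π c ≡ nothing →
             AvoidingFilling ρ λs C E π ⇔ AvoidingFilling ρ (removeAt λs c) (removeAt C c) E (removeAt π c)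
  deletion π c-empty = ColumnDeletion.avoidingFilling-⇔ λs c π c-empty ρ C E c-marked

module RowRelabelling {n : ℕ} (up : ℕ → ℕ) (λs λ′ : Vec ℕ (suc n))
    (pull-back : ∀ c y → (y < lookup λ′ c) ⇔ (up y < lookup λs c))
    (embedding : ∀ a b → (a < b) ⇔ (up a < up b)) where

  raise : Word n → Word n
  raise = Vec.map (Maybe.map up)

  lookup-raise : ∀ π′ c → lookup (raise π′) c ≡ Maybe.map up (lookup π′ c)
  lookup-raise π′ c = lookup-map c (Maybe.map up) π′

  up-injective : ∀ {a b} → up a ≡ up b → a ≡ b
  up-injective {a} {b} eq with ℕ.<-cmp a b
  ... | tri< a<b _ _ = ⊥-elim (ℕ.<-irrefl eq (to (embedding a b) a<b))
  ... | tri≈ _ a≡b _ = a≡b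
  ... | tri> _ _ b<a = ⊥-elim (ℕ.<-irrefl (sym eq) (to (embedding b a) b<a))

  module _ (π′ : Word n) where

    raise-just : ∀ {c y} → lookup π′ c ≡ just y → lookup (raise π′) c ≡ just (up y)
    raise-just {c} eq = trans (lookup-raise π′ c) (Maybe.map-just eq)

    raise-just⁻ : ∀ {c v} → lookup (raise π′) c ≡ just v → ∃[ y ] lookup π′ c ≡ just y × up y ≡ v
    raise-just⁻ {c} eq = preimage (lookup π′ c) (trans (sym (lookup-raise π′ c)) eq)
      where
      preimage : ∀ m {v} → Maybe.map up m ≡ just v → ∃[ y ] m ≡ just y × up y ≡ v
      preimage (just y) refl = y , refl , refl

    filling-⇔ : IsFilling λs (raise π′) ⇔ IsFilling λ′ π′
    filling-⇔ = mk⇔ lower grow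
      where
      lower : IsFilling λs (raise π′) → IsFilling λ′ π′
      lower (inside , rowUnique) =
        (λ c y eq → from (pull-back c y) (inside c (up y) (raise-just eq))) ,
        (λ c c′ y eq eq′ → rowUnique c c′ (up y) (raise-just eq) (raise-just eq′))
      grow : IsFilling λ′ π′ → IsFilling λs (raise π′)
      grow (inside , rowUnique) =
        (λ c v eq → let (y , eq-y , up-y≡v) = raise-just⁻ eq in
                    subst (_< lookup λs c) up-y≡v (to (pull-back c y) (inside c y eq-y))) ,
        (λ c c′ v eq eq′ → let (y , eq-y , up-y≡v) = raise-just⁻ eq
                               (y′ , eq-y′ , up-y′≡v) = raise-just⁻ eq′ in
           rowUnique c c′ y eq-y (subst (λ z → lookup π′ c′ ≡ just z) (up-injective (trans up-y′≡v (sym up-y≡v))) eq-y′))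

    emptyColumns-⇔ : ∀ C → EmptyColumns (raise π′) C ⇔ EmptyColumns π′ C
    emptyColumns-⇔ C = ⇔-onRight raise-nothing
      where
      raise-nothing : ∀ c → (lookup (raise π′) c ≡ nothing) ⇔ (lookup π′ c ≡ nothing)
      raise-nothing c rewrite lookup-raise π′ c with lookup π′ c
      ... | just _ = mk⇔ (λ ()) (λ ())
      ... | nothing = mk⇔ (λ _ → refl) (λ _ → refl)

    rowEmpty-⇔ : ∀ s → RowEmpty (raise π′) (up s) ⇔ RowEmpty π′ s
    rowEmpty-⇔ s = ¬-cong-⇔ (mk⇔ lower (λ (c , eq) → c , raise-just eq))
      where
      lower : ∃[ c ] lookup (raise π′) c ≡ just (up s) → ∃[ c ] lookup π′ c ≡ just s
      lower (c , eq) = let (y , eq-y , up-y≡up-s) = raise-just⁻ eq in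
                       c , subst (λ z → lookup π′ c ≡ just z) (up-injective up-y≡up-s) eq-y

    rowEmpty-outside : ∀ r → (∀ y → up y ≢ r) → RowEmpty (raise π′) r
    rowEmpty-outside r outside (c , eq) = let (y , _ , up-y≡r) = raise-just⁻ eq in outside y up-y≡r

    contains-⇔ : ∀ {k} (ρ : Permutation′ (suc k)) → Contains ρ λs (raise π′) ⇔ Contains ρ λ′ π′
    contains-⇔ {k} ρ = mk⇔ lower grow
      where
      grow : Contains ρ λ′ π′ → Contains ρ λs (raise π′)
      grow (ι , y , increasing , values , order , inside) =
        ι , up ∘ y , increasing , (λ j → raise-just (values j)) ,
        (λ a b → ⇔.trans (⇔.sym (embedding (y a) (y b))) (order a b)) ,
        (λ j → to (pull-back _ (y j)) (inside j))
      lower : Contains ρ λs (raise π′) → Contains ρ λ′ π′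
      lower (ι , v , increasing , values , order , inside) =
        ι , y , increasing , (λ j → proj₁ (proj₂ (preimage j))) ,
        (λ a b → ⇔.trans (embedding (y a) (y b))
                   (subst₂ (λ p q → (p < q) ⇔ ((ρ ⟨$⟩ʳ a) Fin.< (ρ ⟨$⟩ʳ b)))
                           (sym (up-y a)) (sym (up-y b)) (order a b))) ,
        (λ j → from (pull-back _ (y j)) (subst (_< lookup λs (ι (fromℕ k))) (sym (up-y j)) (inside j)))
        where
        preimage : ∀ j → ∃[ y ] lookup π′ (ι j) ≡ just y × up y ≡ v j
        preimage j = raise-just⁻ (values j)
        y : Fin (suc k) → ℕ
        y j = proj₁ (preimage j)
        up-y : ∀ j → up (y j) ≡ v j
        up-y j = proj₂ (proj₂ (preimage j))

-- punchOutℕ r closes the gap at row r (x ↦ x below r, x ↦ x - 1 above r);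
-- punchInℕ r opens it (y ↦ y below r, y ↦ y + 1 from r on).
punchOutℕ : ℕ → ℕ → ℕ
punchOutℕ zero    x       = pred x
punchOutℕ (suc r) zero    = zero
punchOutℕ (suc r) (suc x) = suc (punchOutℕ r x)

punchInℕ : ℕ → ℕ → ℕ
punchInℕ zero    y       = suc y
punchInℕ (suc r) zero    = zero
punchInℕ (suc r) (suc y) = suc (punchInℕ r y)

punchOutℕ-punchInℕ : ∀ r y → punchOutℕ r (punchInℕ r y) ≡ y
punchOutℕ-punchInℕ zero    y       = refl
punchOutℕ-punchInℕ (suc r) zero    = refl
punchOutℕ-punchInℕ (suc r) (suc y) = cong suc (punchOutℕ-punchInℕ r y)

punchInℕ-punchOutℕ : ∀ r {x} → x ≢ r → punchInℕ r (punchOutℕ r x) ≡ x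
punchInℕ-punchOutℕ zero    {zero}  x≢r = ⊥-elim (x≢r refl)
punchInℕ-punchOutℕ zero    {suc x} x≢r = refl
punchInℕ-punchOutℕ (suc r) {zero}  x≢r = refl
punchInℕ-punchOutℕ (suc r) {suc x} x≢r = cong suc (punchInℕ-punchOutℕ r (x≢r ∘ cong suc))

punchInℕ≢ : ∀ r y → punchInℕ r y ≢ r
punchInℕ≢ (suc r) (suc y) eq = punchInℕ≢ r y (ℕ.suc-injective eq)

punchInℕ-galois : ∀ r y h → (y < punchOutℕ r h) ⇔ (punchInℕ r y < h)
punchInℕ-galois zero    y       zero    = mk⇔ (λ ()) (λ ())
punchInℕ-galois zero    y       (suc h) = mk⇔ s≤s s≤s⁻¹
punchInℕ-galois (suc r) zero    zero    = mk⇔ (λ ()) (λ ())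
punchInℕ-galois (suc r) zero    (suc h) = mk⇔ (λ _ → s≤s z≤n) (λ _ → s≤s z≤n)
punchInℕ-galois (suc r) (suc y) zero    = mk⇔ (λ ()) (λ ())
punchInℕ-galois (suc r) (suc y) (suc h) =
  mk⇔ (s≤s ∘ to (punchInℕ-galois r y h) ∘ s≤s⁻¹) (s≤s ∘ from (punchInℕ-galois r y h) ∘ s≤s⁻¹)

-- punchInℕ r is an order embedding (the Galois connection at h = punchInℕ r b).
punchInℕ-embedding : ∀ r a b → (a < b) ⇔ (punchInℕ r a < punchInℕ r b)
punchInℕ-embedding r a b =
  subst (λ z → (a < z) ⇔ (punchInℕ r a < punchInℕ r b)) (punchOutℕ-punchInℕ r b)
        (punchInℕ-galois r a (punchInℕ r b))

punchOutℕ-mono-≤ : ∀ r {a b} → a ≤ b → punchOutℕ r a ≤ punchOutℕ r b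
punchOutℕ-mono-≤ zero    a≤b       = ℕ.pred-mono-≤ a≤b
punchOutℕ-mono-≤ (suc r) {zero} _  = z≤n
punchOutℕ-mono-≤ (suc r) (s≤s a≤b) = s≤s (punchOutℕ-mono-≤ r a≤b)

punchOutℕ-< : ∀ {r h} → r < h → punchOutℕ r h < h
punchOutℕ-< {zero}  {suc h} _         = ℕ.n<1+n h
punchOutℕ-< {suc r} {suc h} (s≤s r<h) = s≤s (punchOutℕ-< r<h)

-- Rows marked from a bound B on stay marked from B on after relabelling.
punchInℕ-≥ : ∀ r s → s ≤ punchInℕ r s
punchInℕ-≥ zero    s       = ℕ.n≤1+n s
punchInℕ-≥ (suc r) zero    = z≤n
punchInℕ-≥ (suc r) (suc s) = s≤s (punchInℕ-≥ r s)

vec-ext : {A : Set} {n : ℕ} {xs ys : Vec A n} → (∀ i → lookup xs i ≡ lookup ys i) → xs ≡ ys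
vec-ext {xs = xs} {ys} eq = trans (sym (tabulate∘lookup xs)) (trans (tabulate-cong eq) (tabulate∘lookup ys))

module RowDeletion {n : ℕ} (λs : Vec ℕ (suc n)) (r : ℕ) where

  λ′ : Vec ℕ (suc n)
  λ′ = Vec.map (punchOutℕ r) λs

  pull-back : ∀ c y → (y < lookup λ′ c) ⇔ (punchInℕ r y < lookup λs c)
  pull-back c y = subst (λ h → (y < h) ⇔ (punchInℕ r y < lookup λs c)) (sym (lookup-map c (punchOutℕ r) λs))
                        (punchInℕ-galois r y (lookup λs c))

  open RowRelabelling (punchInℕ r) λs λ′ pull-back (punchInℕ-embedding r) public

  lower : Word n → Word n
  lower = Vec.map (Maybe.map (punchOutℕ r))

  lower-raise : ∀ π′ → lower (raise π′) ≡ π′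
  lower-raise π′ = vec-ext λ c →
    trans (lookup-map c _ (raise π′)) (trans (cong (Maybe.map (punchOutℕ r)) (lookup-raise π′ c)) (cancel (lookup π′ c)))
    where
    cancel : ∀ m → Maybe.map (punchOutℕ r) (Maybe.map (punchInℕ r) m) ≡ m
    cancel nothing  = refl
    cancel (just y) = cong just (punchOutℕ-punchInℕ r y)

  raise-lower : ∀ π → RowEmpty π r → raise (lower π) ≡ π
  raise-lower π row-r-empty = vec-ext λ c →
    trans (lookup-raise (lower π) c) (trans (cong (Maybe.map (punchInℕ r)) (lookup-map c _ π)) (cancel c (lookup π c) refl))
    where
    cancel : ∀ c m → lookup π c ≡ m → Maybe.map (punchInℕ r) (Maybe.map (punchOutℕ r) m) ≡ m
    cancel c nothing  _  = refl
    cancel c (just x) eq = cong just (punchInℕ-punchOutℕ r (λ x≡r → row-r-empty (c , trans eq (cong just x≡r))))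

  emptyRows-⇔ : ∀ π′ E → E r ≡ true → EmptyRows (raise π′) E ⇔ EmptyRows π′ (E ∘ punchInℕ r)
  emptyRows-⇔ π′ E r-marked = mk⇔ lower-rows raise-rows
    where
    lower-rows : EmptyRows (raise π′) E → EmptyRows π′ (E ∘ punchInℕ r)
    lower-rows rows s = ⇔.trans (rows (punchInℕ r s)) (rowEmpty-⇔ π′ s)
    raise-rows : EmptyRows π′ (E ∘ punchInℕ r) → EmptyRows (raise π′) E
    raise-rows rows x with x ℕ.≟ r
    ... | yes refl = mk⇔ (λ _ → rowEmpty-outside π′ r (punchInℕ≢ r)) (λ _ → r-marked)
    ... | no x≢r = subst (λ z → (E z ≡ true) ⇔ RowEmpty (raise π′) z) (punchInℕ-punchOutℕ r x≢r)
                         (⇔.trans (rows (punchOutℕ r x)) (⇔.sym (rowEmpty-⇔ π′ (punchOutℕ r x))))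

  avoidingFilling-⇔ : ∀ {k} (ρ : Permutation′ (suc k)) C E → E r ≡ true → ∀ π′ →
    AvoidingFilling ρ λs C E (raise π′) ⇔ AvoidingFilling ρ λ′ C (E ∘ punchInℕ r) π′
  avoidingFilling-⇔ ρ C E r-marked π′ =
    filling-⇔ π′ ×-⇔ emptyColumns-⇔ π′ C ×-⇔ emptyRows-⇔ π′ E r-marked ×-⇔ ¬-cong-⇔ (contains-⇔ π′ ρ)

deleteRow : ∀ {k n} (ρ : Permutation′ (suc k)) (λs : Vec ℕ (suc n)) C E r → E r ≡ true →
  Correspondence (AvoidingFilling ρ λs C E) (AvoidingFilling ρ (Vec.map (punchOutℕ r) λs) C (E ∘ punchInℕ r))
deleteRow ρ λs C E r r-marked = record
  { forward = lower
  ; backward = raise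
  ; forward-sound = λ π F →
      to (deletion (lower π)) (subst (AvoidingFilling ρ λs C E) (sym (raise-lower π (row-r-empty π F))) F)
  ; backward-sound = λ π′ → from (deletion π′)
  ; backward-forward = λ π F → raise-lower π (row-r-empty π F)
  ; forward-backward = λ π′ _ → lower-raise π′
  }
  where
  open RowDeletion λs r
  deletion : ∀ π′ → AvoidingFilling ρ λs C E (raise π′) ⇔ AvoidingFilling ρ λ′ C (E ∘ punchInℕ r) π′
  deletion = avoidingFilling-⇔ ρ C E r-marked
  row-r-empty : ∀ π → AvoidingFilling ρ λs C E π → RowEmpty π r
  row-r-empty π (_ , _ , rows , _) = to (rows r) r-marked

standard-⇔ : ∀ {k n} (ρ : Permutation′ (suc k)) (λs : Vec ℕ (suc n)) C E → Decreasing λs →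
  (∀ c → lookup C c ≢ true) → (∀ r → (E r ≡ true) ⇔ (height λs ≤ r)) →
  ∀ π → AvoidingFilling ρ λs C E π ⇔ (IsStandard λs π × Avoids ρ λs π)
standard-⇔ ρ λs C E decreasing unmarked marked π = mk⇔ standard relaxed
  where
  standard : AvoidingFilling ρ λs C E π → IsStandard λs π × Avoids ρ λs π
  standard (filling , columns , rows , avoids) = (filling , column-filled , row-filled) , avoids
    where
    column-filled : ∀ c → ∃[ r ] lookup π c ≡ just r
    column-filled c with lookup π c in eq
    ... | just r  = r , refl
    ... | nothing = ⊥-elim (unmarked c (from (columns c) eq))
    row-filled : ∀ r → r < height λs → ∃[ c ] lookup π c ≡ just r
    row-filled r r<h with any? (λ c → Maybe.≡-dec ℕ._≟_ (lookup π c) (just r))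
    ... | yes filled = filled
    ... | no empty   = ⊥-elim (ℕ.<⇒≱ r<h (to (marked r) (from (rows r) empty)))
  relaxed : IsStandard λs π × Avoids ρ λs π → AvoidingFilling ρ λs C E π
  relaxed ((filling , column-filled , row-filled) , avoids) = filling , columns , rows , avoids
    where
    columns : EmptyColumns π C
    columns c = mk⇔ (⊥-elim ∘ unmarked c) (λ eq → nonempty (trans (sym (proj₂ (column-filled c))) eq))
      where
      nonempty : ∀ {r} {X : Set} → just r ≡ nothing → X
      nonempty ()
    rows : EmptyRows π E
    rows r = ⇔.trans (marked r) (mk⇔
      (λ h≤r (c , eq) → ℕ.<⇒≱ (below-height λs π decreasing filling c eq) h≤r)
      (λ empty → ℕ.≮⇒≥ (λ r<h → empty (row-filled r r<h))))

decreasing-removeAt : ∀ {m} (λs : Vec ℕ (suc (suc m))) c → Decreasing λs → Decreasing (removeAt λs c)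
decreasing-removeAt λs c decreasing i j i≤j =
  subst₂ _≤_ (sym (lookup-removeAt λs c j)) (sym (lookup-removeAt λs c i))
         (decreasing _ _ (punchIn-mono-≤ c i j i≤j))

decreasing-punchOutℕ : ∀ {n} (λs : Vec ℕ (suc n)) r → Decreasing λs → Decreasing (Vec.map (punchOutℕ r) λs)
decreasing-punchOutℕ λs r decreasing i j i≤j =
  subst₂ _≤_ (sym (lookup-map j (punchOutℕ r) λs)) (sym (lookup-map i (punchOutℕ r) λs))
         (punchOutℕ-mono-≤ r (decreasing i j i≤j))

decide-beyond : {P : ℕ → Set} (B : ℕ) → (∀ s → Dec (P s)) → (∀ s → B ≤ s → P s) → Dec (∀ s → P s)
decide-beyond {P} B P? beyond with all? (λ (i : Fin B) → P? (toℕ i))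
... | no ¬below = no (λ everywhere → ¬below (λ i → everywhere (toℕ i)))
... | yes below = yes everywhere
  where
  everywhere : ∀ s → P s
  everywhere s with s <? B
  ... | yes s<B = subst P (toℕ-fromℕ< s<B) (below (fromℕ< s<B))
  ... | no s≮B  = beyond s (ℕ.≮⇒≥ s≮B)

filling-constraints : ∀ {k n} (ρ : Permutation′ (suc k)) (λs : Vec ℕ (suc n)) {C E π} → Decreasing λs →
  (∀ c → lookup C c ≢ true) → AvoidingFilling ρ λs C E π →
  (∀ c → 0 < lookup λs c) × (∀ s → height λs ≤ s → E s ≡ true)
filling-constraints ρ λs {E = E} {π = π} decreasing unmarked (filling , columns , rows , _) = positive , marked
  where
  positive : ∀ c → 0 < lookup λs c
  positive c with lookup π c in eq
  ... | just v  = ℕ.≤-<-trans z≤n (proj₁ filling c v eq)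
  ... | nothing = ⊥-elim (unmarked c (from (columns c) eq))
  marked : ∀ s → height λs ≤ s → E s ≡ true
  marked s h≤s = from (rows s) (λ (c , eq) → ℕ.<⇒≱ (below-height λs π decreasing filling c eq) h≤s)

module Reduction {k l} (σ : Permutation′ (suc k)) (τ : Permutation′ (suc l))
                 (shape-wilf : ShapeWilfEquivalent σ τ) where

  Balanced : ∀ {n} → Vec ℕ (suc n) → Subset (suc n) → (ℕ → Bool) → Set
  Balanced λs C E = SameSize (AvoidingFilling σ λs C E) (AvoidingFilling τ λs C E)

  -- No column and no row below the height is marked: either the data is
  -- that of standard fillings of a Young board, or there is no filling.
  balanced-standard : ∀ {n} (λs : Vec ℕ (suc n)) C E B → Decreasing λs → (∀ c → lookup C c ≢ true) →
    (∀ r → r < height λs → E r ≢ true) → (∀ s → B ≤ s → E s ≡ true) → Balanced λs C E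
  balanced-standard {n} λs C E B decreasing unmarked below beyond = by-cases constraints?
    where
    Constraints : Set
    Constraints = (∀ c → 0 < lookup λs c) × (∀ s → height λs ≤ s → E s ≡ true)
    constraints? : Dec Constraints
    constraints? = all? (λ c → 0 <? lookup λs c) ×-dec
                   decide-beyond B (λ s → height λs ≤? s →-dec E s Bool.≟ true) (λ s B≤s _ → beyond s B≤s)
    by-cases : Dec Constraints → Balanced λs C E
    by-cases (yes (positive , above)) =
      sameSize-transport (pointwise (standard-⇔ σ λs C E decreasing unmarked marked))
                         (pointwise (standard-⇔ τ λs C E decreasing unmarked marked))
                         (shape-wilf n λs (positive , decreasing))
      where
      marked : ∀ r → (E r ≡ true) ⇔ (height λs ≤ r)
      marked r = mk⇔ (λ r-marked → ℕ.≮⇒≥ (λ r<h → below r r<h r-marked)) (above r)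
    by-cases (no violated) =
      sameSize-empty (λ π → violated ∘ filling-constraints σ λs {C} {E} {π} decreasing unmarked)
                     (λ π → violated ∘ filling-constraints τ λs {C} {E} {π} decreasing unmarked)

  balanced-rows : ∀ (fuel : ℕ) {n} (λs : Vec ℕ (suc n)) C E B → height λs ≤ fuel → Decreasing λs →
    (∀ c → lookup C c ≢ true) → (∀ s → B ≤ s → E s ≡ true) → Balanced λs C E
  balanced-rows fuel (h ∷ hs) C E B h≤fuel decreasing unmarked beyond
    with any? (λ (i : Fin h) → E (toℕ i) Bool.≟ true)
  ... | no none = balanced-standard (h ∷ hs) C E B decreasing unmarked below beyond
    where
    below : ∀ r → r < h → E r ≢ true
    below r r<h r-marked = none (fromℕ< r<h , subst (λ z → E z ≡ true) (sym (toℕ-fromℕ< r<h)) r-marked)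
  balanced-rows zero (h ∷ hs) C E B h≤0 decreasing unmarked beyond | yes (i , _) =
    ⊥-elim (ℕ.n≮0 (ℕ.<-≤-trans (toℕ<n i) h≤0))
  balanced-rows (suc fuel) (h ∷ hs) C E B h≤fuel decreasing unmarked beyond | yes (i , r-marked) =
    sameSize-transport (deleteRow σ (h ∷ hs) C E r r-marked) (deleteRow τ (h ∷ hs) C E r r-marked)
      (balanced-rows fuel (Vec.map (punchOutℕ r) (h ∷ hs)) C (E ∘ punchInℕ r) B
        (s≤s⁻¹ (ℕ.<-≤-trans (punchOutℕ-< (toℕ<n i)) h≤fuel))
        (decreasing-punchOutℕ (h ∷ hs) r decreasing) unmarked
        (λ s B≤s → beyond (punchInℕ r s) (ℕ.≤-trans B≤s (punchInℕ-≥ r s))))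
    where
    r = toℕ i

  balanced : ∀ n (λs : Vec ℕ (suc n)) C E B → Decreasing λs → (∀ s → B ≤ s → E s ≡ true) → Balanced λs C E
  balanced n λs C E B decreasing beyond with any? (λ c → lookup C c Bool.≟ true)
  ... | no none =
    balanced-rows (height λs) λs C E B ℕ.≤-refl decreasing (λ c c-marked → none (c , c-marked)) beyond
  -- The only column is marked, hence empty: no pattern occurs at all.
  balanced zero λs C E B decreasing beyond | yes (Fin.zero , marked) =
    sameSize-⇔ (λ π → mk⇔ (swap-pattern σ τ π) (swap-pattern τ σ π))
    where
    swap-pattern : ∀ {j k} (ρ : Permutation′ (suc k)) (ρ′ : Permutation′ (suc j)) π →
                   AvoidingFilling ρ λs C E π → AvoidingFilling ρ′ λs C E π
    swap-pattern ρ ρ′ π (filling , columns , rows , _) =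
      filling , columns , rows , avoids-if-empty ρ′ λs π (λ { Fin.zero → to (columns Fin.zero) marked })
  balanced (suc m) λs C E B decreasing beyond | yes (c , c-marked) =
    sameSize-transport (deleteColumn σ λs C E c c-marked) (deleteColumn τ λs C E c c-marked)
      (balanced m (removeAt λs c) (removeAt C c) E B (decreasing-removeAt λs c decreasing) beyond)

rowMarker : ∀ {n} (λs : Vec ℕ (suc n)) → Subset (height λs) → ℕ → Bool
rowMarker λs R r with r <? height λs
... | yes r<h = lookup R (fromℕ< r<h)
... | no _    = true

rowMarker-beyond : ∀ {n} (λs : Vec ℕ (suc n)) R s → height λs ≤ s → rowMarker λs R s ≡ true
rowMarker-beyond λs R s h≤s with s <? height λs
... | yes s<h = ⊥-elim (ℕ.<⇒≱ s<h h≤s)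
... | no _    = refl

rowMarker-inside : ∀ {n} (λs : Vec ℕ (suc n)) R (r : Fin (height λs)) → rowMarker λs R (toℕ r) ≡ lookup R r
rowMarker-inside λs R r with toℕ r <? height λs
... | yes r<h = cong (lookup R) (fromℕ<-toℕ r r<h)
... | no r≮h  = ⊥-elim (r≮h (toℕ<n r))

rowMarker-∅ : ∀ {n} (λs : Vec ℕ (suc n)) r → (rowMarker λs Subset.⊥ r ≡ true) ⇔ (height λs ≤ r)
rowMarker-∅ λs r with r <? height λs
... | yes r<h = mk⇔ (λ marked → ⊥-elim (false≢true (trans (sym (lookup-replicate (fromℕ< r<h) false)) marked)))
                    (λ h≤r → ⊥-elim (ℕ.<⇒≱ r<h h≤r))
  where
  false≢true : false ≢ true
  false≢true ()
... | no r≮h  = mk⇔ (λ _ → ℕ.≮⇒≥ r≮h) (λ _ → refl)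

∈⇔lookup : ∀ {n} {C : Subset n} {c} → (c ∈ C) ⇔ (lookup C c ≡ true)
∈⇔lookup = mk⇔ []=⇒lookup (lookup⇒[]= _ _)

FrozenFilling : ∀ {k n} → Permutation′ (suc k) → (λs : Vec ℕ (suc n)) → Subset (suc n) → Subset (height λs) →
                Word n → Set
FrozenFilling ρ λs C R π =
  IsFilling λs π × EmptyColumnsExactly π C × EmptyRowsExactly λs π R × Avoids ρ λs π

frozen-⇔ : ∀ {k n} (ρ : Permutation′ (suc k)) (λs : Vec ℕ (suc n)) C R → Decreasing λs →
  ∀ π → FrozenFilling ρ λs C R π ⇔ AvoidingFilling ρ λs C (rowMarker λs R) π
frozen-⇔ ρ λs C R decreasing π = mk⇔
  (λ (filling , columns , rows , avoids) →
     filling , to columns-⇔ columns , to (rows-⇔ filling) rows , avoids)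
  (λ (filling , columns , rows , avoids) →
     filling , from columns-⇔ columns , from (rows-⇔ filling) rows , avoids)
  where
  columns-⇔ : EmptyColumnsExactly π C ⇔ EmptyColumns π C
  columns-⇔ = mk⇔ (λ cols c → ⇔.trans (⇔.sym ∈⇔lookup) (cols c)) (λ cols c → ⇔.trans ∈⇔lookup (cols c))
  rows-⇔ : IsFilling λs π → EmptyRowsExactly λs π R ⇔ EmptyRows π (rowMarker λs R)
  rows-⇔ filling = mk⇔ extend restrict
    where
    extend : EmptyRowsExactly λs π R → EmptyRows π (rowMarker λs R)
    extend rows r with r <? height λs
    ... | yes r<h = subst (λ z → (lookup R (fromℕ< r<h) ≡ true) ⇔ RowEmpty π z) (toℕ-fromℕ< r<h)
                          (⇔.trans (⇔.sym ∈⇔lookup) (rows (fromℕ< r<h)))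
    ... | no r≮h  = mk⇔ (λ _ (c , eq) → r≮h (below-height λs π decreasing filling c eq)) (λ _ → refl)
    restrict : EmptyRows π (rowMarker λs R) → EmptyRowsExactly λs π R
    restrict rows r =
      ⇔.trans ∈⇔lookup (subst (λ b → (b ≡ true) ⇔ RowEmpty π (toℕ r)) (rowMarker-inside λs R r) (rows (toℕ r)))

standard-⇔-frozen : ∀ {k n} (ρ : Permutation′ (suc k)) (λs : Vec ℕ (suc n)) → Decreasing λs →
  ∀ π → (IsStandard λs π × Avoids ρ λs π) ⇔ FrozenFilling ρ λs Subset.⊥ Subset.⊥ π
standard-⇔-frozen ρ λs decreasing π =
  ⇔.trans (⇔.sym (standard-⇔ ρ λs Subset.⊥ (rowMarker λs Subset.⊥) decreasing unmarked (rowMarker-∅ λs) π))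
          (⇔.sym (frozen-⇔ ρ λs Subset.⊥ Subset.⊥ decreasing π))
  where
  unmarked : ∀ c → lookup Subset.⊥ c ≢ true
  unmarked c marked with trans (sym (lookup-replicate c false)) marked
  ... | ()

corollary1p3 : ∀ {k l : ℕ} (σ : Permutation′ (suc k)) (τ : Permutation′ (suc l)) →
    (ShapeWilfEquivalent σ τ ⇔ FillingShapeWilfEquivalent σ τ)
corollary1p3 σ τ = mk⇔ filling-from-shape shape-from-filling
  where
  filling-from-shape : ShapeWilfEquivalent σ τ → FillingShapeWilfEquivalent σ τ
  filling-from-shape shape-wilf n λs (_ , decreasing) C R =
    sameSize-transport (pointwise (frozen-⇔ σ λs C R decreasing)) (pointwise (frozen-⇔ τ λs C R decreasing))
      (Reduction.balanced σ τ shape-wilf n λs C (rowMarker λs R) (height λs) decreasing (rowMarker-beyond λs R))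
  shape-from-filling : FillingShapeWilfEquivalent σ τ → ShapeWilfEquivalent σ τ
  shape-from-filling filling-wilf n λs young@(_ , decreasing) =
    sameSize-transport (pointwise (standard-⇔-frozen σ λs decreasing))
                       (pointwise (standard-⇔-frozen τ λs decreasing))
                       (filling-wilf n λs young Subset.⊥ Subset.⊥)
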